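{- For every run of the roundabout exploration process and every $t\in[N]$, there are no three distinct agents $a_i,a_j,a_l\in A(t)$ with $D_i(t)\cap D_j(t)\cap D_l(t)\neq\emptyset$.
   Context: Let $n\ge2$ and $k\ge1$ be integers, and let $T$ be a tree on a vertex set $V$ with $|V|=n$, rooted at $r$. DFS tour. Fix a depth-first-search tour of $T$ that starts and ends at $r$ and traverses each edge of $T$ exactly twice. Write it as $(v_1,\dots,v_N,v_{N+1})$ with $v_1=v_{N+1}=r$ and $N=2(n-1)$, and put $e_i=\{v_i,v_{i+1}\}$ for $i\in[N]$. Circular intervals. For $i,j\in[N]$, let $[i,j]=\{i,\dots,j\}$ if $i\le j$, and $[i,j]=\{i,\dots,N,1,\dots,j\}$ if $i>j$. Snapshots. Let $G_1,\dots,G_N$ be graphs on $V$, each containing all but at most $k$ edges of $T$. Roundabout exploration process. There are agents $a_1,\dots,a_N$ with initial states $s_i(0)=i$. Set $D_i(0)=\{i\}$ and $A(0)=\{a_1,\dots,a_N\}$. For $t=1,\dots,N$ do: (1) Movement: if $s_i(t-1)=q$, then $s_i(t)=(q\bmod N)+1$ if $e_q\in E(G_t)$, and $s_i(t)=q$ otherwise. (2) Elimination: let $D_i(t)=[i,s_i(t)]$. Starting from $A(t-1)$, repeatedly remove an arbitrary agent $a_i$ of the current set with $D_i(t)\subseteq\bigcup_{a_j\text{ in current set},\,j\neq i}D_j(t)$, until no such agent remains. The result is $A(t)$. A run is any execution of this process, i.e. any choice of removed agents. -}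

module Defs where

open import Data.Bool using (Bool; true; false; if_then_else_; _∧_; _∨_; not)
open import Data.Nat using (ℕ; zero; suc; _+_; _*_; _∸_; _≤_; _<_; _≡ᵇ_; _<ᵇ_)
open import Data.Fin using (Fin; toℕ)
open import Data.Fin.Properties using () renaming (_≟_ to _≟ᶠ_)
open import Data.List using (List; []; _∷_; length; map; upTo; allFin; cartesianProduct)
open import Data.List.Membership.Propositional using (_∈_)
open import Data.List.Relation.Unary.Unique.Propositional using (Unique)
open import Data.Product using (_×_; _,_; Σ; ∃; ∃-syntax)
open import Data.Sum using (_⊎_)
open import Relation.Nullary using (¬_; does)
open import Relation.Binary.PropositionalEquality using (_≡_; _≢_)

count : {A : Set} → (A → Bool) → List A → ℕ
count p []       = 0
count p (x ∷ xs) = if p x then suc (count p xs) else count p xs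

range1 : ℕ → List ℕ
range1 m = map suc (upTo m)

_==_ : {n : ℕ} → Fin n → Fin n → Bool
a == b = does (a ≟ᶠ b)

record Graph (n : ℕ) : Set where
  field
    adj    : Fin n → Fin n → Bool
    sym    : ∀ u w → adj u w ≡ adj w u
    irrefl : ∀ u → adj u u ≡ false
open Graph public

data Walk {n : ℕ} (G : Graph n) : Fin n → Fin n → Set where
  [] : ∀ {u} → Walk G u u
  _∷_ : ∀ {u x w} → adj G u x ≡ true → Walk G x w → Walk G u w

walkVerts : ∀ {n} {G : Graph n} {u w} → Walk G u w → List (Fin n)
walkVerts {u = u} []          = u ∷ []
walkVerts {u = u} (_ ∷ p)     = u ∷ walkVerts p

walkLen : ∀ {n} {G : Graph n} {u w} → Walk G u w → ℕ
walkLen []      = 0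
walkLen (_ ∷ p) = suc (walkLen p)

Connected : ∀ {n} → Graph n → Set
Connected G = ∀ u w → Walk G u w

Acyclic : ∀ {n} → Graph n → Set
Acyclic G = ∀ u w (p : Walk G u w) → Unique (walkVerts p) → 2 ≤ walkLen p →
            adj G w u ≡ false

IsTree : ∀ {n} → Graph n → Set
IsTree G = Connected G × Acyclic G

missingEdges : ∀ {n} → Graph n → Graph n → ℕ
missingEdges {n} T G =
  count (λ ab → let a = Data.Product.proj₁ ab ; b = Data.Product.proj₂ ab in
                 (toℕ a <ᵇ toℕ b) ∧ adj T a b ∧ not (adj G a b))
        (cartesianProduct (allFin n) (allFin n))

tourLen : ℕ → ℕ
tourLen n = 2 * (n ∸ 1)

sameEdge : ∀ {n} → Fin n → Fin n → Fin n → Fin n → Bool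
sameEdge x y a b = (x == a ∧ y == b) ∨ (x == b ∧ y == a)

-- (v₁,…,v_{N+1}) is a closed walk in T from r to r traversing every edge of T
-- exactly twice (in a tree every such walk is a depth-first-search tour).
-- Only the values v 1, …, v (N+1) are relevant.
IsDFSTour : ∀ {n} → Graph n → Fin n → (ℕ → Fin n) → Set
IsDFSTour {n} T r v =
  v 1 ≡ r × v (suc N) ≡ r ×
  (∀ i → 1 ≤ i → i ≤ N → adj T (v i) (v (suc i)) ≡ true) ×
  (∀ a b → adj T a b ≡ true →
     count (λ i → sameEdge (v i) (v (suc i)) a b) (range1 N) ≡ 2)
  where N = tourLen n

InCirc : ℕ → ℕ → ℕ → ℕ → Set
InCirc N i j x =
  (1 ≤ x × x ≤ N) ×
  ((i ≤ j × i ≤ x × x ≤ j) ⊎ (j < i × (i ≤ x ⊎ x ≤ j)))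

module Roundabout {n : ℕ} (v : ℕ → Fin n) (G : ℕ → Graph n) where

  N : ℕ
  N = tourLen n

  next : ℕ → ℕ
  next q = if q ≡ᵇ N then 1 else suc q

  edgeIn : ℕ → ℕ → Bool
  edgeIn t q = adj (G t) (v q) (v (suc q))

  s : ℕ → ℕ → ℕ
  s i zero    = i
  s i (suc t) = if edgeIn (suc t) (s i t) then next (s i t) else s i t

  InD : ℕ → ℕ → ℕ → Set
  InD t i x = InCirc N i (s i t) x

  remove : ℕ → List ℕ → List ℕ
  remove j []       = []
  remove j (x ∷ xs) = if x ≡ᵇ j then remove j xs else x ∷ remove j xs

  Removable : ℕ → List ℕ → ℕ → Set
  Removable t S i = ∀ x → InD t i x → ∃[ j ] (j ∈ S × j ≢ i × InD t j x)

  data ValidElim (t : ℕ) : List ℕ → List ℕ → Set where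
    done : ∀ {S} → (∀ i → i ∈ S → ¬ Removable t S i) → ValidElim t S []
    step : ∀ {S j js} → j ∈ S → Removable t S j →
           ValidElim t (remove j S) js → ValidElim t S (j ∷ js)

  removeAll : List ℕ → List ℕ → List ℕ
  removeAll []       S = S
  removeAll (j ∷ js) S = removeAll js (remove j S)

  alive : (ℕ → List ℕ) → ℕ → List ℕ
  alive rem zero    = range1 N
  alive rem (suc t) = removeAll (rem (suc t)) (alive rem t)

  -- a run: for each time t ∈ [N] the list of agents eliminated at time t
  -- (in order of elimination), subject to the rules of the process
  record Run : Set where
    field
      removed : ℕ → List ℕ
      valid   : ∀ t → 1 ≤ t → t ≤ N → ValidElim t (alive removed (t ∸ 1)) (removed t)

  A : Run → ℕ → List ℕ
  A R = alive (Run.removed R)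

{-# OPTIONS --safe #-}
-- Cut the circle [N] open at the common point x. An arc [i, j] through x is then the union
-- of a forward part, from x up to j, and a backward part, from i up to x; so it is
-- determined by how far forward it reaches and how far back it starts. Of three such arcs
-- let q reach furthest forward, and of the other two let p start later and r earlier.
-- Then D_p ⊆ D_q ∪ D_r, so p is removable from A(t), contradicting the fact that the
-- elimination phase stopped.
module Submission where

open import Defs
open import Data.Nat using (ℕ; zero; suc; _+_; _≤_; _<_; z≤n; s≤s; _≡ᵇ_)
open import Data.Nat.Properties
open import Data.Fin using (Fin)
open import Data.Bool using (T; true; false)
open import Data.Product using (∃-syntax; _×_; _,_; proj₁; proj₂)
open import Data.Sum using (_⊎_; inj₁; inj₂)
open import Data.List using (List; []; _∷_)
open import Data.List.Membership.Propositional using (_∈_)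
open import Data.List.Membership.Propositional.Properties using (∈-map⁻; ∈-upTo⁻)
open import Data.List.Relation.Unary.Any using (here; there)
open import Data.List.Relation.Unary.All as All using (All; []; _∷_)
open import Relation.Nullary using (¬_; yes; no; contradiction)
open import Relation.Binary.PropositionalEquality using (_≡_; _≢_; refl; subst; ≢-sym)

-- Position of y when [N] is read forward from x: x ↦ x, …, N ↦ N, 1 ↦ N + 1, …, x - 1 ↦ N + x - 1.
unroll : ℕ → ℕ → ℕ → ℕ
unroll N x y with x ≤? y
... | yes _ = y
... | no _  = N + y

unroll-ahead : ∀ {N x y} → x ≤ y → unroll N x y ≡ y
unroll-ahead {N} {x} {y} x≤y with x ≤? y
... | yes _   = refl
... | no x≰y = contradiction x≤y x≰y

unroll-behind : ∀ {N x y} → y < x → unroll N x y ≡ N + y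
unroll-behind {N} {x} {y} y<x with x ≤? y
... | yes x≤y = contradiction x≤y (<⇒≱ y<x)
... | no _    = refl

≤-or-> : ∀ x y → x ≤ y ⊎ y < x
≤-or-> x y with x ≤? y
... | yes x≤y = inj₁ x≤y
... | no x≰y  = inj₂ (≰⇒> x≰y)

-- The start i is unrolled from x + 1, so that for i = x the backward part is empty.
InUnrolled : ℕ → ℕ → ℕ → ℕ → ℕ → Set
InUnrolled N x i j y = unroll N x y ≤ unroll N x j ⊎ unroll N (suc x) i ≤ unroll N x y

record ArcThrough (N x i j : ℕ) : Set where
  field
    1≤start : 1 ≤ i
    start≤N : i ≤ N
    end≤N   : j ≤ N
    ∋x      : InCirc N i j x

module _ {N x i j : ℕ} (arc : ArcThrough N x i j) where
  open ArcThrough arc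

  InCirc⇒InUnrolled : ∀ {y} → InCirc N i j y → InUnrolled N x i j y
  InCirc⇒InUnrolled {y} ((_ , y≤N) , y∈) with ∋x
  ... | _ , inj₁ (i≤j , i≤x , x≤j)
    rewrite unroll-ahead {N} x≤j | unroll-behind {N} (s≤s i≤x) with ≤-or-> x y | y∈
  ...   | inj₁ x≤y | inj₁ (_ , _ , y≤j) rewrite unroll-ahead {N} x≤y = inj₁ y≤j
  ...   | inj₂ y<x | inj₁ (_ , i≤y , _) rewrite unroll-behind {N} y<x = inj₂ (+-monoʳ-≤ N i≤y)
  ...   | _        | inj₂ (j<i , _)     = contradiction i≤j (<⇒≱ j<i)
  InCirc⇒InUnrolled {y} ((_ , y≤N) , y∈) | _ , inj₂ (j<i , inj₁ i≤x)
    rewrite unroll-behind {N} (<-≤-trans j<i i≤x) | unroll-behind {N} (s≤s i≤x) with ≤-or-> x y | y∈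
  ...   | inj₁ x≤y | _ rewrite unroll-ahead {N} x≤y = inj₁ (≤-trans y≤N (m≤m+n N j))
  ...   | inj₂ y<x | inj₁ (i≤j , _)      = contradiction i≤j (<⇒≱ j<i)
  ...   | inj₂ y<x | inj₂ (_ , inj₁ i≤y) rewrite unroll-behind {N} y<x = inj₂ (+-monoʳ-≤ N i≤y)
  ...   | inj₂ y<x | inj₂ (_ , inj₂ y≤j) rewrite unroll-behind {N} y<x = inj₁ (+-monoʳ-≤ N y≤j)
  InCirc⇒InUnrolled {y} ((_ , y≤N) , y∈) | _ , inj₂ (j<i , inj₂ x≤j)
    rewrite unroll-ahead {N} x≤j | unroll-ahead {N} (≤-<-trans x≤j j<i) with ≤-or-> x y | y∈
  ...   | inj₂ y<x | _ rewrite unroll-behind {N} y<x = inj₂ (≤-trans start≤N (m≤m+n N y))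
  ...   | inj₁ x≤y | inj₁ (i≤j , _)      = contradiction i≤j (<⇒≱ j<i)
  ...   | inj₁ x≤y | inj₂ (_ , inj₁ i≤y) rewrite unroll-ahead {N} x≤y = inj₂ i≤y
  ...   | inj₁ x≤y | inj₂ (_ , inj₂ y≤j) rewrite unroll-ahead {N} x≤y = inj₁ y≤j

  InUnrolled⇒InCirc : ∀ {y} → 1 ≤ y → y ≤ N → InUnrolled N x i j y → InCirc N i j y
  InUnrolled⇒InCirc {y} 1≤y y≤N with ∋x
  ... | _ , inj₁ (i≤j , i≤x , x≤j)
    rewrite unroll-ahead {N} x≤j | unroll-behind {N} (s≤s i≤x) with ≤-or-> x y
  ...   | inj₁ x≤y rewrite unroll-ahead {N} x≤y = λ
    { (inj₁ y≤j)   → (1≤y , y≤N) , inj₁ (i≤j , ≤-trans i≤x x≤y , y≤j)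
    ; (inj₂ N+i≤y) → contradiction (≤-trans N+i≤y y≤N) (<⇒≱ (m<m+n N 1≤start)) }
  ...   | inj₂ y<x rewrite unroll-behind {N} y<x = λ
    { (inj₁ N+y≤j) → contradiction (≤-trans N+y≤j end≤N) (<⇒≱ (m<m+n N 1≤y))
    ; (inj₂ N+i≤N+y) → (1≤y , y≤N) , inj₁ (i≤j , +-cancelˡ-≤ N _ _ N+i≤N+y , ≤-trans (<⇒≤ y<x) x≤j) }
  InUnrolled⇒InCirc {y} 1≤y y≤N | _ , inj₂ (j<i , inj₁ i≤x)
    rewrite unroll-behind {N} (<-≤-trans j<i i≤x) | unroll-behind {N} (s≤s i≤x) with ≤-or-> x y
  ...   | inj₁ x≤y = λ _ → (1≤y , y≤N) , inj₂ (j<i , inj₁ (≤-trans i≤x x≤y))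
  ...   | inj₂ y<x rewrite unroll-behind {N} y<x = λ
    { (inj₁ N+y≤N+j) → (1≤y , y≤N) , inj₂ (j<i , inj₂ (+-cancelˡ-≤ N _ _ N+y≤N+j))
    ; (inj₂ N+i≤N+y) → (1≤y , y≤N) , inj₂ (j<i , inj₁ (+-cancelˡ-≤ N _ _ N+i≤N+y)) }
  InUnrolled⇒InCirc {y} 1≤y y≤N | _ , inj₂ (j<i , inj₂ x≤j)
    rewrite unroll-ahead {N} x≤j | unroll-ahead {N} (≤-<-trans x≤j j<i) with ≤-or-> x y
  ...   | inj₁ x≤y rewrite unroll-ahead {N} x≤y = λ
    { (inj₁ y≤j) → (1≤y , y≤N) , inj₂ (j<i , inj₂ y≤j)
    ; (inj₂ i≤y) → (1≤y , y≤N) , inj₂ (j<i , inj₁ i≤y) }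
  ...   | inj₂ y<x = λ _ → (1≤y , y≤N) , inj₂ (j<i , inj₂ (≤-trans (<⇒≤ y<x) x≤j))

InCirc-⊆-∪ : ∀ {N x i j i₁ j₁ i₂ j₂ y} →
  ArcThrough N x i j → ArcThrough N x i₁ j₁ → ArcThrough N x i₂ j₂ →
  unroll N x j ≤ unroll N x j₁ → unroll N (suc x) i₂ ≤ unroll N (suc x) i →
  InCirc N i j y → InCirc N i₁ j₁ y ⊎ InCirc N i₂ j₂ y
InCirc-⊆-∪ arc arc₁ arc₂ j≤j₁ i₂≤i y∈@((1≤y , y≤N) , _) with InCirc⇒InUnrolled arc y∈
... | inj₁ y≤j = inj₁ (InUnrolled⇒InCirc arc₁ 1≤y y≤N (inj₁ (≤-trans y≤j j≤j₁)))
... | inj₂ i≤y = inj₂ (InUnrolled⇒InCirc arc₂ 1≤y y≤N (inj₂ (≤-trans i₂≤i i≤y)))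

record Dominated {A : Set} (f g : A → ℕ) (xs : List A) : Set where
  field
    p q r   : A
    p∈xs    : p ∈ xs
    q∈xs    : q ∈ xs
    r∈xs    : r ∈ xs
    q≢p     : q ≢ p
    r≢p     : r ≢ p
    fp≤fq   : f p ≤ f q
    gr≤gp   : g r ≤ g p

module _ {A : Set} (f g : A → ℕ) where

  dominated-below-max : ∀ {xs m u w} → m ∈ xs → u ∈ xs → w ∈ xs → u ≢ m → w ≢ m → u ≢ w →
                        f u ≤ f m → f w ≤ f m → Dominated f g xs
  dominated-below-max {u = u} {w} m∈ u∈ w∈ u≢m w≢m u≢w fu≤fm fw≤fm with ≤-total (g u) (g w)
  ... | inj₁ gu≤gw = record { p∈xs = w∈ ; q∈xs = m∈ ; r∈xs = u∈ ; q≢p = ≢-sym w≢m ; r≢p = u≢w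
                            ; fp≤fq = fw≤fm ; gr≤gp = gu≤gw }
  ... | inj₂ gw≤gu = record { p∈xs = u∈ ; q∈xs = m∈ ; r∈xs = w∈ ; q≢p = ≢-sym u≢m ; r≢p = ≢-sym u≢w
                            ; fp≤fq = fu≤fm ; gr≤gp = gw≤gu }

  module _ {i j l : A} (i≢j : i ≢ j) (j≢l : j ≢ l) (i≢l : i ≢ l) where
    private
      i∈ : i ∈ i ∷ j ∷ l ∷ []
      i∈ = here refl
      j∈ : j ∈ i ∷ j ∷ l ∷ []
      j∈ = there (here refl)
      l∈ : l ∈ i ∷ j ∷ l ∷ []
      l∈ = there (there (here refl))

    dominated-of-three : Dominated f g (i ∷ j ∷ l ∷ [])
    dominated-of-three with ≤-total (f i) (f j)
    ... | inj₁ fi≤fj with ≤-total (f j) (f l)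
    ...   | inj₁ fj≤fl = dominated-below-max l∈ i∈ j∈ i≢l j≢l i≢j (≤-trans fi≤fj fj≤fl) fj≤fl
    ...   | inj₂ fl≤fj = dominated-below-max j∈ i∈ l∈ i≢j (≢-sym j≢l) i≢l fi≤fj fl≤fj
    dominated-of-three | inj₂ fj≤fi with ≤-total (f i) (f l)
    ...   | inj₁ fi≤fl = dominated-below-max l∈ i∈ j∈ i≢l j≢l i≢j fi≤fl (≤-trans fj≤fi fi≤fl)
    ...   | inj₂ fl≤fi = dominated-below-max i∈ j∈ l∈ (≢-sym i≢j) (≢-sym i≢l) j≢l fj≤fi fl≤fi

module _ {A : Set} (N x : ℕ) (start end : A → ℕ) where

  one-of-three-covered : ∀ {S : List A} {i j l} → i ≢ j → j ≢ l → i ≢ l →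
    All (λ a → a ∈ S × ArcThrough N x (start a) (end a)) (i ∷ j ∷ l ∷ []) →
    ∃[ p ] (p ∈ S × ∀ y → InCirc N (start p) (end p) y →
                      ∃[ q ] (q ∈ S × q ≢ p × InCirc N (start q) (end q) y))
  one-of-three-covered {S} {i} {j} {l} i≢j j≢l i≢l through = p , member p∈xs , covered
    where
    reach origin : A → ℕ
    reach a  = unroll N x (end a)
    origin a = unroll N (suc x) (start a)
    open Dominated (dominated-of-three reach origin i≢j j≢l i≢l)
    member : ∀ {a} → a ∈ i ∷ j ∷ l ∷ [] → a ∈ S
    member a∈ = proj₁ (All.lookup through a∈)
    arc : ∀ {a} → a ∈ i ∷ j ∷ l ∷ [] → ArcThrough N x (start a) (end a)
    arc a∈ = proj₂ (All.lookup through a∈)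
    covered : ∀ y → InCirc N (start p) (end p) y →
              ∃[ a ] (a ∈ S × a ≢ p × InCirc N (start a) (end a) y)
    covered y y∈ with InCirc-⊆-∪ (arc p∈xs) (arc q∈xs) (arc r∈xs) fp≤fq gr≤gp y∈
    ... | inj₁ y∈q = q , member q∈xs , q≢p , y∈q
    ... | inj₂ y∈r = r , member r∈xs , r≢p , y∈r

range1-bounds : ∀ {m i} → i ∈ range1 m → 1 ≤ i × i ≤ m
range1-bounds i∈ with ∈-map⁻ suc i∈
... | _ , k∈ , refl = s≤s z≤n , ∈-upTo⁻ k∈

module RoundaboutProperties {n : ℕ} (v : ℕ → Fin n) (G : ℕ → Graph n) where
  open Roundabout v G

  remove-⊆ : ∀ {a} j S → a ∈ remove j S → a ∈ S
  remove-⊆ j (b ∷ S) a∈ with b ≡ᵇ j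
  ... | true = there (remove-⊆ j S a∈)
  remove-⊆ j (b ∷ S) (here a≡b) | false = here a≡b
  remove-⊆ j (b ∷ S) (there a∈) | false = there (remove-⊆ j S a∈)

  removeAll-⊆ : ∀ {a} js S → a ∈ removeAll js S → a ∈ S
  removeAll-⊆ []       S a∈ = a∈
  removeAll-⊆ (j ∷ js) S a∈ = remove-⊆ j S (removeAll-⊆ js (remove j S) a∈)

  alive-⊆ : ∀ {a} rem t → a ∈ alive rem t → a ∈ range1 N
  alive-⊆ rem zero    a∈ = a∈
  alive-⊆ rem (suc t) a∈ = alive-⊆ rem t (removeAll-⊆ (rem (suc t)) (alive rem t) a∈)

  next-≤ : ∀ {q} → 1 ≤ N → q ≤ N → next q ≤ N
  next-≤ {q} 1≤N q≤N with q ≡ᵇ N in q≡ᵇN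
  ... | true  = 1≤N
  ... | false = ≤∧≢⇒< q≤N (λ q≡N → subst T q≡ᵇN (≡⇒≡ᵇ q N q≡N))

  s-≤ : ∀ {i} → 1 ≤ N → i ≤ N → ∀ t → s i t ≤ N
  s-≤ 1≤N i≤N zero = i≤N
  s-≤ {i} 1≤N i≤N (suc t) with edgeIn (suc t) (s i t)
  ... | true  = next-≤ 1≤N (s-≤ 1≤N i≤N t)
  ... | false = s-≤ 1≤N i≤N t

  arc-of-alive : ∀ R t {a x} → a ∈ A R t → InD t a x → ArcThrough N x a (s a t)
  arc-of-alive R t a∈ x∈ with range1-bounds (alive-⊆ (Run.removed R) t a∈)
  ... | 1≤a , a≤N = record
    { 1≤start = 1≤a ; start≤N = a≤N ; end≤N = s-≤ (≤-trans 1≤a a≤N) a≤N t ; ∋x = x∈ }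

  ValidElim-irremovable : ∀ {t S js} → ValidElim t S js →
                          ¬ (∃[ a ] (a ∈ removeAll js S × Removable t (removeAll js S) a))
  ValidElim-irremovable (done irremovable) (a , a∈ , removable) = irremovable a a∈ removable
  ValidElim-irremovable (step _ _ elim)    = ValidElim-irremovable elim

  alive-irremovable : ∀ R t → 1 ≤ t → t ≤ N → ¬ (∃[ a ] (a ∈ A R t × Removable t (A R t) a))
  alive-irremovable R zero    ()
  alive-irremovable R (suc t) _ 1+t≤N = ValidElim-irremovable (Run.valid R (suc t) (s≤s z≤n) 1+t≤N)

lemma6 : (n k : ℕ) → 2 ≤ n → 1 ≤ k →
           (T : Graph n) → IsTree T → (r : Fin n) →
           (v : ℕ → Fin n) → IsDFSTour T r v →
           (G : ℕ → Graph n) →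
           (∀ t → 1 ≤ t → t ≤ tourLen n → missingEdges T (G t) ≤ k) →
           (R : Roundabout.Run v G) →
           ∀ t → 1 ≤ t → t ≤ tourLen n →
           ∀ i j l → i ≢ j → j ≢ l → i ≢ l →
           i ∈ Roundabout.A v G R t → j ∈ Roundabout.A v G R t → l ∈ Roundabout.A v G R t →
           ¬ (∃[ x ] (Roundabout.InD v G t i x × Roundabout.InD v G t j x × Roundabout.InD v G t l x))
lemma6 _ _ _ _ _ _ _ v _ G _ R t 1≤t t≤N i j l i≢j j≢l i≢l i∈A j∈A l∈A (x , x∈Di , x∈Dj , x∈Dl) =
  alive-irremovable R t 1≤t t≤N
    (one-of-three-covered N x (λ a → a) (λ a → s a t) i≢j j≢l i≢l
      ((i∈A , arc i∈A x∈Di) ∷ (j∈A , arc j∈A x∈Dj) ∷ (l∈A , arc l∈A x∈Dl) ∷ []))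
  where
  open Roundabout v G
  open RoundaboutProperties v G
  arc : ∀ {a} → a ∈ A R t → InD t a x → ArcThrough N x a (s a t)
  arc = arc-of-alive R t
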